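{- Let $G=(V,E)$ be a graph on $n$ vertices, $k\ge 0$ an integer, $c$ a $2$-valid edge coloring of $G$ using at least $n-k$ colors, and $H$ a character subgraph of $G$ with respect to $c$. Then $|V(G)\setminus V(H)|\le k$.
   Context: All graphs are finite, simple and undirected. An edge coloring of $G$ using $m$ colors is a surjective map $c:E\to[m]$; it is $2$-valid if for every vertex $v$ the edges incident to $v$ receive at most $2$ distinct colors. A character subgraph of $G$ with respect to $c$ is obtained by choosing, for each color $i\in[m]$, one edge $e_i$ with $c(e_i)=i$, and letting $H$ be the subgraph formed by the edges $e_1,\dots,e_m$ and their endpoints. -}

module Defs where

open import Data.Nat using (ℕ; _≤_; _∸_)
open import Data.Fin using (Fin; _<_)
open import Data.Fin.Properties using (_≟_; any?)
open import Data.Bool using (Bool; T; true; false)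
open import Data.Product using (Σ; _×_; _,_; proj₁; proj₂; ∃)
open import Data.Sum using (_⊎_)
open import Data.List using (List; length; filter; allFin)
open import Relation.Nullary using (¬_; Dec)

open import Relation.Nullary.Decidable using (_⊎-dec_; ¬?)
open import Relation.Binary.PropositionalEquality using (_≡_)
open import Function.Definitions using (Surjective)

record Graph (n : ℕ) : Set where
  field
    adj    : Fin n → Fin n → Bool
    sym    : ∀ u v → adj u v ≡ adj v u
    irrefl : ∀ v → adj v v ≡ false
open Graph public

-- An edge {u,v} is represented canonically by the ordered pair (u , v) with u < v.
Edge : ∀ {n} → Graph n → Set
Edge {n} G = Σ (Fin n × Fin n) λ p → (proj₁ p < proj₂ p) × T (adj G (proj₁ p) (proj₂ p))

_∈ₑ_ : ∀ {n} {G : Graph n} → Fin n → Edge G → Set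
v ∈ₑ e = (v ≡ proj₁ (proj₁ e)) ⊎ (v ≡ proj₂ (proj₁ e))

_∈ₑ?_ : ∀ {n} {G : Graph n} (v : Fin n) (e : Edge G) → Dec (_∈ₑ_ {G = G} v e)
v ∈ₑ? e = (v ≟ proj₁ (proj₁ e)) ⊎-dec (v ≟ proj₂ (proj₁ e))

record EdgeColoring {n} (G : Graph n) (m : ℕ) : Set where
  field
    col  : Edge G → Fin m
    surj : Surjective _≡_ _≡_ col
open EdgeColoring public

-- 2-valid: at every vertex the incident edges carry at most 2 distinct colours,
-- i.e. among any three edges incident to v, two have the same colour.
TwoValid : ∀ {n m} {G : Graph n} → EdgeColoring G m → Set
TwoValid {n} {m} {G} c =
  ∀ (v : Fin n) (e₁ e₂ e₃ : Edge G) → _∈ₑ_ {G = G} v e₁ → _∈ₑ_ {G = G} v e₂ → _∈ₑ_ {G = G} v e₃ →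
    (col c e₁ ≡ col c e₂) ⊎ (col c e₁ ≡ col c e₃) ⊎ (col c e₂ ≡ col c e₃)

record Character {n m} {G : Graph n} (c : EdgeColoring G m) : Set where
  field
    pick    : Fin m → Edge G
    pick-ok : ∀ i → col c (pick i) ≡ i
open Character public

InH : ∀ {n m} {G : Graph n} {c : EdgeColoring G m} → Character c → Fin n → Set
InH {m = m} {G = G} H v = ∃ λ (i : Fin m) → _∈ₑ_ {G = G} v (pick H i)

InH? : ∀ {n m} {G : Graph n} {c : EdgeColoring G m} (H : Character c) (v : Fin n) → Dec (InH H v)
InH? {G = G} H v = any? (λ i → _∈ₑ?_ {G = G} v (pick H i))

missing : ∀ {n m} {G : Graph n} {c : EdgeColoring G m} → Character c → ℕ
missing {n} H = length (filter (λ v → ¬? (InH? H v)) (allFin n))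

-- Each chosen edge of H has two endpoints, and every vertex of H lies on at most two chosen
-- edges, since those edges carry pairwise distinct colours and the colouring is 2-valid.
-- Counting vertex–edge incidences both ways gives 2m ≤ 2|V(H)|, so |V(H)| ≥ m ≥ n − k.
module Submission where

open import Defs hiding (sym)
open import Data.Nat using (ℕ; zero; suc; _+_; _*_; _≤_; _∸_; z≤n; s≤s; NonZero)
open import Data.Nat.Properties
  using ( +-*-semiring; ≤-refl; ≤-reflexive; ≤-trans; module ≤-Reasoning; m≤m+n; m≤n+m∸n
        ; +-mono-≤; +-monoʳ-≤; +-cancelʳ-≤; *-comm; *-identityʳ; *-cancelˡ-≤)
open import Algebra.Properties.Semiring.Sum +-*-semiring
  using (sum-syntax; sum-remove; ∑-comm; ∑-distrib-+; sum-cong-≗; *-distribˡ-sum)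
open import Data.Fin using (Fin; punchOut) renaming (zero to fzero; suc to fsuc)
open import Data.Fin.Properties using (0≢1+n; suc-injective; punchIn-punchOut; <⇒≢)
open import Data.List using (length; filter; tabulate)
open import Data.Product using (_,_)
open import Data.Sum using (_⊎_; inj₁; inj₂; map)
open import Data.Vec.Functional using (removeAt)
open import Function using (_∘_; id)
open import Level using (Level)
open import Relation.Nullary using (¬_; Dec; yes; no; contradiction)
open import Relation.Nullary.Decidable using (¬?)
open import Relation.Unary using (Pred; Decidable)
open import Relation.Binary.PropositionalEquality
  using (_≡_; _≢_; refl; sym; trans; cong; module ≡-Reasoning)

private
  variable
    a ℓ : Level
    A : Set a
    n m : ℕ

𝟙 : Dec A → ℕ
𝟙 (yes _) = 1
𝟙 (no _)  = 0

𝟙-yes : (A? : Dec A) → A → 1 ≤ 𝟙 A?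
𝟙-yes (yes _) _ = ≤-refl
𝟙-yes (no ¬x) x = contradiction x ¬x

𝟙-¬?+𝟙≡1 : (A? : Dec A) → 𝟙 (¬? A?) + 𝟙 A? ≡ 1
𝟙-¬?+𝟙≡1 (yes _) = refl
𝟙-¬?+𝟙≡1 (no _)  = refl

∑-const : ∀ n x → ∑[ i < n ] x ≡ n * x
∑-const zero    x = refl
∑-const (suc n) x = cong (x +_) (∑-const n x)

∑-mono-≤ : {f g : Fin n → ℕ} → (∀ i → f i ≤ g i) → ∑[ i < n ] f i ≤ ∑[ i < n ] g i
∑-mono-≤ {zero}  f≤g = z≤n
∑-mono-≤ {suc n} f≤g = +-mono-≤ (f≤g fzero) (∑-mono-≤ (f≤g ∘ fsuc))

∑-≥-term : (f : Fin n → ℕ) (i : Fin n) → f i ≤ ∑[ j < n ] f j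
∑-≥-term {suc n} f i = ≤-trans (m≤m+n (f i) _) (≤-reflexive (sym (sum-remove f)))

∑-≥-two-terms : (f : Fin n → ℕ) {i j : Fin n} → i ≢ j → f i + f j ≤ ∑[ k < n ] f k
∑-≥-two-terms {suc n} f {i} {j} i≢j = begin
  f i + f j                                ≡⟨ cong (λ k → f i + f k) (punchIn-punchOut i≢j) ⟨
  f i + removeAt f i (punchOut i≢j)        ≤⟨ +-monoʳ-≤ (f i) (∑-≥-term (removeAt f i) _) ⟩
  f i + ∑[ k < n ] removeAt f i k          ≡⟨ sum-remove f ⟨
  ∑[ k < suc n ] f k                       ∎
  where open ≤-Reasoning

count : {P : Pred (Fin n) ℓ} → Decidable P → ℕ
count {n} P? = ∑[ i < n ] 𝟙 (P? i)

length-filter-tabulate : {Q : Pred A ℓ} (Q? : Decidable Q) (f : Fin n → A) →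
                         length (filter Q? (tabulate f)) ≡ count (Q? ∘ f)
length-filter-tabulate {n = zero}  Q? f = refl
length-filter-tabulate {n = suc n} Q? f with Q? (f fzero)
... | yes _ = cong suc (length-filter-tabulate Q? (f ∘ fsuc))
... | no _  = length-filter-tabulate Q? (f ∘ fsuc)

count-¬?+count≡n : {P : Pred (Fin n) ℓ} (P? : Decidable P) → count (¬? ∘ P?) + count P? ≡ n
count-¬?+count≡n {n} P? = begin
  count (¬? ∘ P?) + count P?           ≡⟨ ∑-distrib-+ (𝟙 ∘ ¬? ∘ P?) (𝟙 ∘ P?) ⟨
  ∑[ i < n ] (𝟙 (¬? (P? i)) + 𝟙 (P? i)) ≡⟨ sum-cong-≗ (𝟙-¬?+𝟙≡1 ∘ P?) ⟩
  ∑[ i < n ] 1                          ≡⟨ ∑-const n 1 ⟩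
  n * 1                                 ≡⟨ *-identityʳ n ⟩
  n                                     ∎
  where open ≡-Reasoning

count-none : {P : Pred (Fin n) ℓ} (P? : Decidable P) → (∀ i → ¬ P i) → count P? ≡ 0
count-none {zero}  P? ¬P = refl
count-none {suc n} P? ¬P with P? fzero
... | yes p = contradiction p (¬P fzero)
... | no _  = count-none (P? ∘ fsuc) (¬P ∘ fsuc)

count-≤1 : {P : Pred (Fin n) ℓ} (P? : Decidable P) →
           (∀ {i j} → P i → P j → i ≡ j) → count P? ≤ 1
count-≤1 {zero}  P? unique = z≤n
count-≤1 {suc n} P? unique with P? fzero
... | yes p = ≤-reflexive (cong suc (count-none (P? ∘ fsuc) (λ i q → 0≢1+n (unique p q))))
... | no _  = count-≤1 (P? ∘ fsuc) (λ p q → suc-injective (unique p q))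

AtMostTwo : Pred A ℓ → Set _
AtMostTwo P = ∀ {i j k} → P i → P j → P k → i ≡ j ⊎ i ≡ k ⊎ j ≡ k

count-≤2 : {P : Pred (Fin n) ℓ} (P? : Decidable P) → AtMostTwo P → count P? ≤ 2
count-≤2 {zero}  P? two = z≤n
count-≤2 {suc n} {P = P} P? two with P? fzero
... | yes p = s≤s (count-≤1 (P? ∘ fsuc) unique)
  where
  unique : ∀ {i j} → P (fsuc i) → P (fsuc j) → i ≡ j
  unique q r with two p q r
  ... | inj₁ ()
  ... | inj₂ (inj₁ ())
  ... | inj₂ (inj₂ eq) = suc-injective eq
... | no _  = count-≤2 (P? ∘ fsuc) (λ p q r →
                map suc-injective (map suc-injective suc-injective) (two p q r))

double-counting : (r : ℕ) .{{_ : NonZero r}} (I : Fin m → Fin n → ℕ) (w : Fin n → ℕ) →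
                  (∀ i → r ≤ ∑[ v < n ] I i v) → (∀ v → ∑[ i < m ] I i v ≤ r * w v) →
                  m ≤ ∑[ v < n ] w v
double-counting {m} {n} r I w row≥ column≤ = *-cancelˡ-≤ r (begin
  r * m                          ≡⟨ *-comm r m ⟩
  m * r                          ≡⟨ ∑-const m r ⟨
  ∑[ i < m ] r                   ≤⟨ ∑-mono-≤ row≥ ⟩
  ∑[ i < m ] ∑[ v < n ] I i v    ≡⟨ ∑-comm I ⟩
  ∑[ v < n ] ∑[ i < m ] I i v    ≤⟨ ∑-mono-≤ column≤ ⟩
  ∑[ v < n ] (r * w v)           ≡⟨ *-distribˡ-sum r w ⟨
  r * ∑[ v < n ] w v             ∎)
  where open ≤-Reasoning

module _ {G : Graph n} where

  endpoints : Edge G → ℕ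
  endpoints e = count (λ v → _∈ₑ?_ {G = G} v e)

  edge-has-two-endpoints : (e : Edge G) → 2 ≤ endpoints e
  edge-has-two-endpoints e@((u , v) , u<v , _) = begin
    1 + 1                    ≤⟨ +-mono-≤ (𝟙-yes (u ∈? e) (inj₁ refl)) (𝟙-yes (v ∈? e) (inj₂ refl)) ⟩
    𝟙 (u ∈? e) + 𝟙 (v ∈? e)  ≤⟨ ∑-≥-two-terms (λ x → 𝟙 (x ∈? e)) (<⇒≢ u<v) ⟩
    endpoints e              ∎
    where
    open ≤-Reasoning
    _∈?_ = _∈ₑ?_ {G = G}

module _ {G : Graph n} {c : EdgeColoring G m} (H : Character c) where

  meets : Fin n → Fin m → Set
  meets v i = _∈ₑ_ {G = G} v (pick H i)

  meets? : ∀ v → Decidable (meets v)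
  meets? v i = _∈ₑ?_ {G = G} v (pick H i)

  pick-injective : ∀ {i j} → col c (pick H i) ≡ col c (pick H j) → i ≡ j
  pick-injective {i} {j} eq = trans (sym (pick-ok H i)) (trans eq (pick-ok H j))

  order : ℕ
  order = count (InH? H)

  vertex-meets-at-most-two-picks : TwoValid c → ∀ v → count (meets? v) ≤ 2 * 𝟙 (InH? H v)
  vertex-meets-at-most-two-picks twoValid v with InH? H v
  ... | yes _  = count-≤2 (meets? v) (λ p q r →
                   map pick-injective (map pick-injective pick-injective) (twoValid v _ _ _ p q r))
  ... | no v∉H = ≤-reflexive (count-none (meets? v) (λ i p → v∉H (i , p)))

  colours≤order : TwoValid c → m ≤ order
  colours≤order twoValid = double-counting 2 (λ i v → 𝟙 (meets? v i)) (𝟙 ∘ InH? H)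
    (edge-has-two-endpoints {G = G} ∘ pick H) (vertex-meets-at-most-two-picks twoValid)

  missing+order≡n : missing H + order ≡ n
  missing+order≡n = trans (cong (_+ order) (length-filter-tabulate (¬? ∘ InH? H) id))
                          (count-¬?+count≡n (InH? H))

complement-bound : ∀ {a b n k} → a + b ≡ n → n ∸ k ≤ b → a ≤ k
complement-bound {a} {b} {n} {k} a+b≡n n∸k≤b = +-cancelʳ-≤ b a k (begin
  a + b        ≡⟨ a+b≡n ⟩
  n            ≤⟨ m≤n+m∸n n k ⟩
  k + (n ∸ k)  ≤⟨ +-monoʳ-≤ k n∸k≤b ⟩
  k + b        ∎)
  where open ≤-Reasoning

mainTheorem8 : (n k m : ℕ) (G : Graph n) (c : EdgeColoring G m) →
    TwoValid c → n ∸ k ≤ m → (H : Character c) → missing H ≤ k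
mainTheorem8 n k m G c twoValid n∸k≤m H =
  complement-bound (missing+order≡n H) (≤-trans n∸k≤m (colours≤order H twoValid))
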